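{- Let $\varphi$ be a safety LTL specification over $\mathtt{AP}$, let $\mathcal{A}=(Q,q_0,\delta,\Omega)$ be its deterministic safety automaton, and let $\mathcal{U}=(\mathcal{A},\kappa)$ be the universal safety controller for $\varphi$. Let $\mathcal{W}=(\mathcal{A},\underline{\kappa},\overline{\kappa})$ be an approximation of $\mathcal{U}$, i.e., $\underline{\kappa},\overline{\kappa}\colon Q\times 2^{O_{\mathtt{c}}}\to 2^{\mathbb{P}}$ satisfy $\underline{\kappa}(q,\alpha)\subseteq\kappa(q,\alpha)\subseteq\overline{\kappa}(q,\alpha)$ for all $q\in Q$ and $\alpha\subseteq O_{\mathtt{c}}$. Then the prophecy controller $(\mathcal{A},\underline{\kappa})$ is correct for every plant $\mathcal{M}_{\mathtt{p}}\in\mathbb{P}$, and the prophecy controller $(\mathcal{A},\overline{\kappa})$ is most permissive for every plant $\mathcal{M}_{\mathtt{p}}\in\mathbb{P}$.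
   Context: Atomic propositions $\mathtt{AP}=O_{\mathtt{e}}\uplus O_{\mathtt{c}}\uplus O_{\mathtt{p}}$ are partitioned into the outputs of an environment $\mathtt{e}$, a controller $\mathtt{c}$ and a plant $\mathtt{p}$; the inputs of process $i$ are $I_i=\bigcup_{j\neq i}O_j$; $\Sigma=2^{\mathtt{AP}}$. A strategy for process $i$ is a Moore machine $\mathcal{M}=(S,s_0,\tau,o)$ with finite $S$, $\tau\colon S\times 2^{I_i}\to S$, $o\colon S\to 2^{O_i}$; on an input sequence $\alpha_0\alpha_1\cdots$ it visits $s_0s_1\cdots$ with $s_{j+1}=\tau(s_j,\alpha_j)$ and outputs $o(s_0)o(s_1)\cdots$. $\mathit{Traces}(\mathcal{M})$ is the set of $\gamma\in\Sigma^\omega$ such that on input $(\gamma[j]\cap I_i)_j$ the machine outputs $(\gamma[j]\cap O_i)_j$; $\mathcal{M}\models\varphi$ iff all its traces satisfy $\varphi$. $\mathcal{M}(s)$ denotes the same machine with initial state $s$; $\mathit{out}(\mathcal{M},\epsilon)=o(s_0)$. $\mathbb{P}$ and $\mathbb{C}$ are the sets of all plant and controller strategies. The parallel composition of $\mathcal{M}_i=(S_i,s^i_0,\tau_i,o_i)$ and $\mathcal{M}_j=(S_j,s^j_0,\tau_j,o_j)$ is the Moore machine with states $S_i\times S_j$, initial state $(s^i_0,s^j_0)$, inputs $(I_i\cup I_j)\setminus(O_i\cup O_j)$, outputs $O_i\cup O_j$, $\tau((s,s'),\sigma)=(\tau_i(s,(\sigma\cup o_j(s'))\cap I_i),\tau_j(s',(\sigma\cup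 o_i(s))\cap I_j))$ and $o((s,s'))=o_i(s)\cup o_j(s')$. A deterministic safety automaton $\mathcal{A}=(Q,q_0,\delta,\Omega)$ has $\delta\colon Q\times\Sigma\to Q$ and $\Omega$ the set of state sequences staying in a set $F\subseteq Q$ of safe states; $\mathcal{L}(\mathcal{A})=\mathcal{L}(\varphi)$. For a Moore machine $\mathcal{M}$ with outputs $O$, the product $\mathcal{A}\times\mathcal{M}$ has states $Q\times S$, initial state $(q_0,s_0)$, and partial transition $\delta'((q,s),\sigma)=(\delta(q,\sigma),\tau(s,\sigma))$ defined iff $\sigma\cap O=o(s)$; reachable states are those reachable from the initial state. $\mathit{Runs}(\mathcal{A},q,\mathcal{M})$ is the set of runs of $\mathcal{A}$ from $q$ that are first components of runs of $\mathcal{A}\times\mathcal{M}$ from $(q,s_0)$. A prophecy is a set of plants. A prophecy controller is a pair $(\mathcal{A},\kappa)$ with $\kappa\colon Q\times 2^{O_{\mathtt{c}}}\to 2^{\mathbb{P}}$. A controller $\mathcal{M}_{\mathtt{c}}=(S^{\mathtt{c}},s^{\mathtt{c}}_0,\tau^{\mathtt{c}},o^{\mathtt{c}})$ is consistent with $(\mathcal{A},\kappa)$ w.r.t. plant $\mathcal{M}_{\mathtt{p}}$ if for every reachable state $(q,s^{\mathtt{p}},s^{\mathtt{c}})$ of $\mathcal{A}\times(\mathcal{M}_{\mathtt{c}}\parallel\mathcal{M}_{\mathtt{p}})$ we have $\mathcal{M}_{\mathtt{p}}(s^{\mathtt{p}})\in\kappa(q,o^{\mathtt{c}}(s^{\mathtt{c}}))$.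 The prophecy controller is correct for $\mathcal{M}_{\mathtt{p}}$ if every controller consistent with it w.r.t. $\mathcal{M}_{\mathtt{p}}$ satisfies $\mathcal{M}_{\mathtt{p}}\parallel\mathcal{M}_{\mathtt{c}}\models\varphi$; it is most permissive for $\mathcal{M}_{\mathtt{p}}$ if every $\mathcal{M}_{\mathtt{c}}$ with $\mathcal{M}_{\mathtt{p}}\parallel\mathcal{M}_{\mathtt{c}}\models\varphi$ is consistent with it w.r.t. $\mathcal{M}_{\mathtt{p}}$. The universal safety controller (from prior work) for $\varphi$ is the prophecy controller $\mathcal{U}=(\mathcal{A},\kappa)$ with $\kappa(q,\alpha)=\{\mathcal{M}_{\mathtt{p}}\in\mathbb{P}\mid\exists\mathcal{M}_{\mathtt{c}}\in\mathbb{C}.\ \mathit{out}(\mathcal{M}_{\mathtt{c}},\epsilon)=\alpha\wedge \mathit{Runs}(\mathcal{A},q,\mathcal{M}_{\mathtt{p}}\parallel\mathcal{M}_{\mathtt{c}})\subseteq\Omega\}$; it is known to be correct and most permissive for every plant (and forward-complete: any plant in $\kappa(q,\alpha)$ admits a controller consistent with $(\mathcal{A},\kappa)$ started at $q$). -}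

module Defs where

open import Data.Nat using (ℕ; suc; _<_)
open import Data.Nat.Properties using (*-comm)
open import Data.Fin using (Fin)
open import Data.Fin.Properties using (*↔×)
open import Data.Fin.Subset using (Subset; _∈_)
open import Data.Bool using (Bool; true)
open import Data.Product using (Σ; ∃; _×_; _,_; proj₁; proj₂)
open import Data.Product.Function.NonDependent.Propositional using (_×-↔_)
open import Function.Bundles using (_↔_; _⇔_)
open import Function.Properties.Inverse using (↔-trans; ↔-sym)
open import Relation.Binary.PropositionalEquality using (_≡_)
open import Relation.Nullary using (¬_)
open import Level using (Level; suc; zero; _⊔_)

Finite : Set → Set
Finite S = Σ ℕ λ n → S ↔ Fin n

record Moore (I O : Set) : Set₁ where
  field
    S   : Set
    fin : Finite S
    s₀  : S
    τ   : S → I → S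
    o   : S → O

_at_ : ∀ {I O} (M : Moore I O) → Moore.S M → Moore I O
M at s = record { S = Moore.S M ; fin = Moore.fin M ; s₀ = s ; τ = Moore.τ M ; o = Moore.o M }

out-ε : ∀ {I O} → Moore I O → O
out-ε M = Moore.o M (Moore.s₀ M)

run : ∀ {I O} (M : Moore I O) → (ℕ → I) → ℕ → Moore.S M
run M α ℕ.zero = Moore.s₀ M
run M α (ℕ.suc j) = Moore.τ M (run M α j) (α j)

-- The setting: |O_e| = ne, |O_c| = nc, |O_p| = np.
module Setup (ne nc np : ℕ) where

  data AP : Set where
    envAP  : Fin ne → AP
    ctrlAP : Fin nc → AP
    plntAP : Fin np → AP

  E C P : Set
  E = Subset ne
  C = Subset nc
  P = Subset np

  -- Σ = 2^AP ≅ 2^{O_e} × 2^{O_c} × 2^{O_p}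
  Letter : Set
  Letter = E × C × P

  envPart : Letter → E
  envPart (e , c , p) = e
  ctrlPart : Letter → C
  ctrlPart (e , c , p) = c
  plntPart : Letter → P
  plntPart (e , c , p) = p

  holds : AP → Letter → Set
  holds (envAP x)  σ = x ∈ envPart σ
  holds (ctrlAP x) σ = x ∈ ctrlPart σ
  holds (plntAP x) σ = x ∈ plntPart σ

  Word : Set
  Word = ℕ → Letter

  data LTL : Set where
    tt  : LTL
    atom : AP → LTL
    ¬ₗ_ : LTL → LTL
    _∧ₗ_ : LTL → LTL → LTL
    Xₗ  : LTL → LTL
    _Uₗ_ : LTL → LTL → LTL

  _,_⊨_ : Word → ℕ → LTL → Set
  w , i ⊨ tt = Data.Unit.⊤ where import Data.Unit
  w , i ⊨ atom a = holds a (w i)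
  w , i ⊨ (¬ₗ φ) = ¬ (w , i ⊨ φ)
  w , i ⊨ (φ ∧ₗ ψ) = (w , i ⊨ φ) × (w , i ⊨ ψ)
  w , i ⊨ Xₗ φ = w , ℕ.suc i ⊨ φ
  w , i ⊨ (φ Uₗ ψ) = ∃ λ k → (w , i Data.Nat.+ k ⊨ ψ) × (∀ j → j < k → w , i Data.Nat.+ j ⊨ φ)
    where import Data.Nat

  _⊨ₗ_ : Word → LTL → Set
  w ⊨ₗ φ = w , 0 ⊨ φ

  -- strategies: process i reads I_i = ⋃_{j≠i} O_j and writes O_i
  Plant Controller : Set₁
  Plant = Moore (E × C) P
  Controller = Moore (E × P) C

  System : Set₁
  System = Moore E (C × P)

  _∥_ : Plant → Controller → System
  Mp ∥ Mc = record
    { S = Moore.S Mp × Moore.S Mc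
    ; fin = finprod (Moore.fin Mp) (Moore.fin Mc)
    ; s₀ = Moore.s₀ Mp , Moore.s₀ Mc
    ; τ = λ { (sp , sc) e → Moore.τ Mp sp (e , Moore.o Mc sc) , Moore.τ Mc sc (e , Moore.o Mp sp) }
    ; o = λ { (sp , sc) → Moore.o Mc sc , Moore.o Mp sp }
    }
    where
    finprod : ∀ {A B} → Finite A → Finite B → Finite (A × B)
    finprod (m , f) (n , g) = m Data.Nat.* n , ↔-trans (f ×-↔ g) (↔-sym *↔×)
      where import Data.Nat

  Traces : System → Word → Set
  Traces M γ = ∀ j → Moore.o M (run M (λ k → envPart (γ k)) j) ≡ (ctrlPart (γ j) , plntPart (γ j))

  _⊨ₛ_ : System → LTL → Set
  M ⊨ₛ φ = ∀ γ → Traces M γ → γ ⊨ₗ φ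

  record SafetyAutomaton : Set₁ where
    field
      Q   : Set
      fin : Finite Q
      q₀  : Q
      δ   : Q → Letter → Q
      F   : Q → Set

  module _ (𝒜 : SafetyAutomaton) where
    open SafetyAutomaton 𝒜

    runA : Word → ℕ → Q
    runA w ℕ.zero = q₀
    runA w (ℕ.suc j) = δ (runA w j) (w j)

    -- Ω: state sequences staying in F
    InΩ : (ℕ → Q) → Set
    InΩ r = ∀ j → F (r j)

    Lang : Word → Set
    Lang w = InΩ (runA w)

    data Reachable (M : System) : Q → Moore.S M → Set where
      init : Reachable M q₀ (Moore.s₀ M)
      step : ∀ {q s} (σ : Letter) → Reachable M q s →
             (ctrlPart σ , plntPart σ) ≡ Moore.o M s →
             Reachable M (δ q σ) (Moore.τ M s (envPart σ))

    -- Runs(𝒜, q, M): first components of runs of 𝒜 × M from (q, s₀)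
    Runs : Q → System → (ℕ → Q) → Set
    Runs q M r = Σ Word λ w → Σ (ℕ → Moore.S M) λ s →
        (r 0 ≡ q) × (s 0 ≡ Moore.s₀ M) ×
        (∀ j → ((ctrlPart (w j) , plntPart (w j)) ≡ Moore.o M (s j))
             × (r (ℕ.suc j) ≡ δ (r j) (w j))
             × (s (ℕ.suc j) ≡ Moore.τ M (s j) (envPart (w j))))

    Prophecy : Set₂
    Prophecy = Plant → Set₁

    Kappa : Set₂
    Kappa = Q → C → Prophecy

    Consistent : Kappa → Controller → Plant → Set₁
    Consistent κ Mc Mp = ∀ q sp sc → Reachable (Mp ∥ Mc) q (sp , sc) →
                         κ q (Moore.o Mc sc) (Mp at sp)

    Correct : LTL → Kappa → Plant → Set₁
    Correct φ κ Mp = ∀ Mc → Consistent κ Mc Mp → (Mp ∥ Mc) ⊨ₛ φ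

    MostPermissive : LTL → Kappa → Plant → Set₁
    MostPermissive φ κ Mp = ∀ Mc → (Mp ∥ Mc) ⊨ₛ φ → Consistent κ Mc Mp

    κU : Kappa
    κU q α Mp = Σ Controller λ Mc → (out-ε Mc ≡ α) ×
                (∀ r → Runs q (Mp ∥ Mc) r → InΩ r)

    Approximation : Kappa → Kappa → Set₁
    Approximation κl κh = ∀ q α Mp →
      ((κl q α Mp → κU q α Mp) × (κU q α Mp → κh q α Mp))

-- The universal safety controller κU is itself correct and most permissive for
-- every plant, while correctness is antitone and most permissiveness monotone in
-- κ; both properties therefore transfer along κ̲ ⊆ κU ⊆ κ̄.
-- Correctness of κU: a state at which some closed loop has only safe runs is
-- itself safe, and consistency puts such a closed loop at every state a trace
-- visits. Most permissiveness of κU: if Mp ∥ Mc ⊨ φ, all runs from q₀ are safe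
-- (they are the traces of Mp ∥ Mc), this propagates forward to every reachable
-- state (q, (sp , sc)), and there the residual controller Mc(sc) witnesses κU.
module Submission where

open import Defs
open import Data.Nat using (ℕ; zero; suc)
open import Data.Product using (Σ; _×_; _,_; proj₁; proj₂)
open import Data.Fin.Subset using (⊥)
open import Function.Base using (_∘_)
open import Function.Bundles using (_⇔_; Equivalence)
open import Relation.Binary.PropositionalEquality
  using (_≡_; _≗_; refl; sym; trans; cong; subst)

_◂_ : {A : Set} → A → (ℕ → A) → ℕ → A
(a ◂ f) zero    = a
(a ◂ f) (suc j) = f j

module _ {ne nc np : ℕ} where
  open Setup ne nc np

  module SafetyControl (𝒜 : SafetyAutomaton) where
    open SafetyAutomaton 𝒜

    _⊆κ_ : Kappa 𝒜 → Kappa 𝒜 → Set₁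
    κ ⊆κ κ′ = ∀ q α Mp → κ q α Mp → κ′ q α Mp

    Consistent-mono : ∀ {κ κ′ Mc Mp} → κ ⊆κ κ′ → Consistent 𝒜 κ Mc Mp → Consistent 𝒜 κ′ Mc Mp
    Consistent-mono {Mc = Mc} {Mp} κ⊆κ′ consistent q sp sc reach =
      κ⊆κ′ q (Moore.o Mc sc) (Mp at sp) (consistent q sp sc reach)

    Correct-antitone : ∀ {κ κ′} φ Mp → κ ⊆κ κ′ → Correct 𝒜 φ κ′ Mp → Correct 𝒜 φ κ Mp
    Correct-antitone φ Mp κ⊆κ′ correct Mc consistent =
      correct Mc (Consistent-mono {Mc = Mc} {Mp} κ⊆κ′ consistent)

    MostPermissive-mono : ∀ {κ κ′} φ Mp → κ ⊆κ κ′ →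
                          MostPermissive 𝒜 φ κ Mp → MostPermissive 𝒜 φ κ′ Mp
    MostPermissive-mono φ Mp κ⊆κ′ mostPermissive Mc sat =
      Consistent-mono {Mc = Mc} {Mp} κ⊆κ′ (mostPermissive Mc sat)

    SafeFrom : Q → System → Set
    SafeFrom q M = ∀ r → Runs 𝒜 q M r → InΩ 𝒜 r

    Runs-inhabited : ∀ q (M : System) → Σ (ℕ → Q) (Runs 𝒜 q M)
    Runs-inhabited q M = r , w , s , refl , refl , λ _ → refl , refl , refl
      where
      s : ℕ → Moore.S M
      s = run M (λ _ → ⊥)
      w : Word
      w j = ⊥ , Moore.o M (s j)
      r : ℕ → Q
      r zero    = q
      r (suc j) = δ (r j) (w j)

    SafeFrom⇒F : ∀ {q} M → SafeFrom q M → F q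
    SafeFrom⇒F {q} M safe with Runs-inhabited q M
    ... | r , ρ@(_ , _ , r₀≡q , _) = subst F r₀≡q (safe r ρ 0)

    SafeFrom-step : ∀ {q} {M : System} {s} σ → (ctrlPart σ , plntPart σ) ≡ Moore.o M s →
                    SafeFrom q (M at s) → SafeFrom (δ q σ) (M at Moore.τ M s (envPart σ))
    SafeFrom-step {q} {M} {s} σ out≡ safe r (w , st , r₀ , st₀ , step≡) j =
      safe (q ◂ r) (σ ◂ w , s ◂ st , refl , refl , step≡′) (suc j)
      where
      step≡′ : ∀ k → ((ctrlPart ((σ ◂ w) k) , plntPart ((σ ◂ w) k)) ≡ Moore.o M ((s ◂ st) k))
                   × ((q ◂ r) (suc k) ≡ δ ((q ◂ r) k) ((σ ◂ w) k))
                   × ((s ◂ st) (suc k) ≡ Moore.τ M ((s ◂ st) k) (envPart ((σ ◂ w) k)))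
      step≡′ zero    = out≡ , r₀ , st₀
      step≡′ (suc k) = step≡ k

    Reachable⇒SafeFrom : ∀ {M q s} → SafeFrom q₀ M → Reachable 𝒜 M q s → SafeFrom q (M at s)
    Reachable⇒SafeFrom safe init                 = safe
    Reachable⇒SafeFrom {M} safe (step σ reach out≡) =
      SafeFrom-step {M = M} σ out≡ (Reachable⇒SafeFrom safe reach)

    Traces⇒Reachable : ∀ {M γ} → Traces M γ → ∀ j →
                       Reachable 𝒜 M (runA 𝒜 γ j) (run M (envPart ∘ γ) j)
    Traces⇒Reachable traces zero    = init
    Traces⇒Reachable traces (suc j) = step _ (Traces⇒Reachable traces j) (sym (traces j))

    Runs-from-q₀ : ∀ {M r} (ρ : Runs 𝒜 q₀ M r) → Traces M (proj₁ ρ) × (runA 𝒜 (proj₁ ρ) ≗ r)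
    Runs-from-q₀ {M} {r} (w , st , r₀ , st₀ , step≡) = traces , runA≗r
      where
      run≗st : run M (envPart ∘ w) ≗ st
      run≗st zero    = sym st₀
      run≗st (suc j) = trans (cong (λ s → Moore.τ M s (envPart (w j))) (run≗st j))
                             (sym (proj₂ (proj₂ (step≡ j))))
      traces : Traces M w
      traces j = trans (cong (Moore.o M) (run≗st j)) (sym (proj₁ (step≡ j)))
      runA≗r : runA 𝒜 w ≗ r
      runA≗r zero    = sym r₀
      runA≗r (suc j) = trans (cong (λ q → δ q (w j)) (runA≗r j)) (sym (proj₁ (proj₂ (step≡ j))))

    module _ (φ : LTL) (L≡φ : ∀ w → Lang 𝒜 w ⇔ (w ⊨ₗ φ)) where

      ⊨ₛ⇒SafeFrom : ∀ {M} → M ⊨ₛ φ → SafeFrom q₀ M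
      ⊨ₛ⇒SafeFrom {M} sat r ρ j with Runs-from-q₀ {M} ρ
      ... | traces , runA≗r = subst F (runA≗r j) (Equivalence.from (L≡φ _) (sat _ traces) j)

      κU-correct : ∀ Mp → Correct 𝒜 φ (κU 𝒜) Mp
      κU-correct Mp Mc consistent γ traces = Equivalence.to (L≡φ γ) safe
        where
        safe : Lang 𝒜 γ
        safe j with run (Mp ∥ Mc) (envPart ∘ γ) j | Traces⇒Reachable {Mp ∥ Mc} traces j
        ... | sp , sc | reach with consistent _ sp sc reach
        ... | Mc′ , _ , safeFrom = SafeFrom⇒F ((Mp at sp) ∥ Mc′) safeFrom

      κU-mostPermissive : ∀ Mp → MostPermissive 𝒜 φ (κU 𝒜) Mp
      κU-mostPermissive Mp Mc sat q sp sc reach =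
        Mc at sc , refl , Reachable⇒SafeFrom (⊨ₛ⇒SafeFrom {Mp ∥ Mc} sat) reach

lemma1 : (ne nc np : ℕ) → let open Setup ne nc np in
    (φ : LTL) (𝒜 : SafetyAutomaton) →
    (∀ w → Lang 𝒜 w ⇔ (w ⊨ₗ φ)) →
    (κl κh : Kappa 𝒜) → Approximation 𝒜 κl κh →
    (∀ Mp → Correct 𝒜 φ κl Mp) × (∀ Mp → MostPermissive 𝒜 φ κh Mp)
lemma1 ne nc np φ 𝒜 L≡φ κl κh approximation =
    (λ Mp → Correct-antitone φ Mp κl⊆κU (κU-correct φ L≡φ Mp))
  , (λ Mp → MostPermissive-mono φ Mp κU⊆κh (κU-mostPermissive φ L≡φ Mp))
  where
  open Setup ne nc np
  open SafetyControl 𝒜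
  κl⊆κU : κl ⊆κ κU 𝒜
  κl⊆κU q α Mp = proj₁ (approximation q α Mp)
  κU⊆κh : κU 𝒜 ⊆κ κh
  κU⊆κh q α Mp = proj₂ (approximation q α Mp)
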